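{- Let $\{W_n\}_{n\ge0}$ be the Lehmer numbers. For all nonnegative integers $n,m$ and every positive integer $k$, if $3n\equiv 3m \pmod{2\cdot 3^k}$, then $W_{3n}\equiv W_{3m}\pmod{3^{k+1}}$.
   Context: The Lehmer numbers $W_n$ are defined by $\sum_{n=0}^\infty W_n\frac{z^n}{n!}=\frac{3}{e^z+e^{\omega z}+e^{\omega^2 z}}=\left(\sum_{n=0}^\infty \frac{z^{3n}}{(3n)!}\right)^{ -1}$, where $\omega=-\tfrac12+\tfrac{\sqrt{ -3}}{2}$. They are integers. -}

module Defs where

open import Data.Nat as ℕ using (ℕ; zero; suc; _%_)
open import Data.Nat.Combinatorics using (_C_)
open import Data.Integer as ℤ using (ℤ; +_; -_; _*_; _+_)
open import Data.List using (List; []; _∷_; zipWith; upTo; foldr; head)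
open import Data.Maybe using (fromMaybe)

-- The Lehmer numbers W_n are defined by the exponential generating function
--   Σ W_n z^n / n! = (Σ z^{3n}/(3n)!)^{-1}.
-- Equivalently (comparing coefficients of the product with Σ z^{3n}/(3n)!):
--   W_0 = 1,   Σ_{j : 3j ≤ n} C(n,3j) W_{n-3j} = 0 for n ≥ 1,
-- i.e.  W_n = - Σ_{1 ≤ j, 3j ≤ n} C(n,3j) W_{n-3j}.

-- term i of the sum in the recursion for W_{n+1}, where w = W_{n-i}:
-- contributes C(n+1, i+1) W_{n-i} iff 3 ∣ i+1.
step-term : ℕ → ℕ → ℤ → ℤ
step-term n i w with (suc i) % 3
... | zero  = + ((suc n) C (suc i)) * w
... | suc _ = + 0

sumℤ : List ℤ → ℤ
sumℤ = foldr _+_ (+ 0)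

-- Ws n = W_n ∷ W_{n-1} ∷ … ∷ W_0
Ws : ℕ → List ℤ
Ws zero    = (+ 1) ∷ []
Ws (suc n) = (- sumℤ (zipWith (step-term n) (upTo (suc n)) prev)) ∷ prev
  where prev = Ws n

W : ℕ → ℤ
W n = fromMaybe (+ 0) (head (Ws n))

-- Let C(z) = Σ z³ⁿ/(3n)!, so that W(z) = 1/C(z), and let ω be a primitive cube root of unity.
-- The coefficients φ n of e^(-z) C(z) = (1 + e^((ω-1)z) + e^((ω²-1)z))/3 satisfy
-- φ (n+3) = -3 φ (n+2) - 3 φ (n+1), so 3^⌊(n-1)/2⌋ ∣ φ n. As the exponent of 3 in n! is at most
-- ⌊(n-1)/2⌋, e^(-z) C(z) is a power series over ℤ₍₃₎ with constant term 1, hence so is its inverse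
-- e^z W(z) = Σ g n zⁿ/n!. Newton's expansion around M reads
--   W (M + L) = Σⱼ (-1)^(L-j) C(L,j) Tⱼ  with  Tⱼ = Σᵢ C(j,i) W (M+i) = Σᵢ (-1)^(M-i) C(M,i) g (i+j),
-- so j! ∣ Tⱼ in ℤ₍₃₎. If 3 ∣ M, then T₀ = T₁ = T₂ = W M because W vanishes off 3ℕ, and 9 ∣ T₃.
-- If moreover L is even and 3^(k+1) ∣ L, then
--   W (M + L) - W M = (C(L,2) - L) W M - C(L,3) T₃ + Σ_{j≥4} (-1)^(L-j) C(L,j) Tⱼ,
-- where 2 (C(L,2) - L) = L (L-3), 3^k ∣ C(L,3), and C(L,j) j! = L (j-1)! C(L-1,j-1) with 3 ∣ (j-1)!;
-- so every term is divisible by 3^(k+2).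
module Submission where

-- Here _∣_ is signed divisibility on ℤ, while corollary3p6 is phrased with the unsigned one.
module LehmerNumbers where

  open import Data.Nat.Base as ℕ using (ℕ; zero; suc; _≤_; _<_; _∸_; _!; _^_; _/_; _%_; z≤n; s≤s; pred; ⌊_/2⌋)
  import Data.Nat.Properties as ℕ
  open import Data.Nat.Properties using (_!*_!≢0)
  import Data.Nat.Divisibility as ℕ
  open import Data.Nat.DivMod using (m≡m%n+[m/n]*n; m%n<n; m/n<m; m/n*n≡m)
  open import Data.Nat.Induction using (<-rec)
  open import Data.Nat.Combinatorics using (_C_; nC1≡n; nCk≡n!/k![n-k]!; k![n∸k]!∣n!; nCk+nC[k+1]≡[n+1]C[k+1])
  open import Data.Nat.Combinatorics.Specification using (k>n⇒nCk≡0)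
  open import Data.Nat.Primality using (Prime; prime?; euclidsLemma; prime⇒nonZero; ¬prime[1])
  import Data.Nat.Tactic.RingSolver as ℕ-Solver
  open import Data.Integer.Base as ℤ using (ℤ; +_; -_; _+_; _-_; _*_; 0ℤ; 1ℤ)
  import Data.Integer.Properties as ℤ
  open import Data.Integer.Divisibility using () renaming (_∣_ to _∣ᵤ_)
  open import Data.Integer.Divisibility.Signed
    using ( _∣_; divides; ∣-refl; ∣-trans; ∣m∣n⇒∣m+n; ∣m∣n⇒∣m-n; ∣m⇒∣-m; ∣n⇒∣m*n; ∣m⇒∣m*n
          ; *-monoʳ-∣; *-monoˡ-∣; *-cancelˡ-∣; ∣ᵤ⇒∣; ∣⇒∣ᵤ)
  open import Data.Integer.Tactic.RingSolver using (solve-∀)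
  open import Algebra.Properties.AbelianGroup ℤ.+-0-abelianGroup using (inverseˡ-unique)
  open import Algebra.Properties.CommutativeSemigroup ℤ.+-commutativeSemigroup using (interchange; x∙yz≈y∙xz)
  open import Data.List.Base using (zipWith; applyUpTo)
  open import Data.Product.Base using (∃-syntax; _×_; _,_)
  open import Data.Sum.Base using (_⊎_; inj₁; inj₂; [_,_]; [_,_]′)
  import Data.Sum.Base as Sum
  open import Function.Base using (id; _∘_)
  open import Relation.Binary.PropositionalEquality using (_≡_; refl; sym; trans; cong; cong₂; subst; subst₂; module ≡-Reasoning)
  open import Relation.Nullary.Decidable using (yes; no; from-yes; from-no)
  open import Relation.Nullary.Negation using (¬_; contradiction)
  open import Defs using (W; Ws; step-term; sumℤ)

  -- Finite sums

  sum≤ : ℕ → (ℕ → ℤ) → ℤ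
  sum≤ zero    f = f 0
  sum≤ (suc n) f = f 0 + sum≤ n (f ∘ suc)

  syntax sum≤ n (λ i → e) = ∑[ i ≤ n ] e

  sum≤-closed : (P : ℤ → Set) → (∀ {a b} → P a → P b → P (a + b)) →
                ∀ n {f} → (∀ i → i ≤ n → P (f i)) → P (sum≤ n f)
  sum≤-closed P P-+ zero    Pf = Pf 0 z≤n
  sum≤-closed P P-+ (suc n) Pf = P-+ (Pf 0 z≤n) (sum≤-closed P P-+ n (λ i i≤n → Pf (suc i) (s≤s i≤n)))

  sum≤-cong : ∀ n {f g} → (∀ i → i ≤ n → f i ≡ g i) → sum≤ n f ≡ sum≤ n g
  sum≤-cong zero    f≡g = f≡g 0 z≤n
  sum≤-cong (suc n) f≡g = cong₂ _+_ (f≡g 0 z≤n) (sum≤-cong n (λ i i≤n → f≡g (suc i) (s≤s i≤n)))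

  sum≤-distrib-+ : ∀ n (f g : ℕ → ℤ) → ∑[ i ≤ n ] (f i + g i) ≡ sum≤ n f + sum≤ n g
  sum≤-distrib-+ zero    f g = refl
  sum≤-distrib-+ (suc n) f g =
    trans (cong (_+_ (f 0 + g 0)) (sum≤-distrib-+ n _ _)) (interchange (f 0) (g 0) _ _)

  sum≤-neg : ∀ n (f : ℕ → ℤ) → ∑[ i ≤ n ] (- f i) ≡ - sum≤ n f
  sum≤-neg zero    f = refl
  sum≤-neg (suc n) f = trans (cong (_+_ (- f 0)) (sum≤-neg n _)) (sym (ℤ.neg-distrib-+ (f 0) _))

  sum≤-suc : ∀ n (f : ℕ → ℤ) → sum≤ (suc n) f ≡ sum≤ n f + f (suc n)
  sum≤-suc zero    f = refl
  sum≤-suc (suc n) f = trans (cong (_+_ (f 0)) (sum≤-suc n (f ∘ suc))) (sym (ℤ.+-assoc (f 0) _ _))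

  sum≤-zero : ∀ n {f} → (∀ i → i ≤ n → f i ≡ 0ℤ) → sum≤ n f ≡ 0ℤ
  sum≤-zero = sum≤-closed (_≡ 0ℤ) (λ a≡0 b≡0 → cong₂ _+_ a≡0 b≡0)

  ∣-sum≤ : ∀ n {x f} → (∀ i → i ≤ n → x ∣ f i) → x ∣ sum≤ n f
  ∣-sum≤ n {x} = sum≤-closed (x ∣_) ∣m∣n⇒∣m+n n

  sum≤-split : ∀ n {f g h} → (∀ i → f i ≡ g i + h i) → sum≤ n f ≡ sum≤ n g + sum≤ n h
  sum≤-split n f≡g+h = trans (sum≤-cong n (λ i _ → f≡g+h i)) (sum≤-distrib-+ n _ _)

  sum≤-split⁻ : ∀ n {f g h} → (∀ i → f i ≡ g i - h i) → sum≤ n f ≡ sum≤ n g - sum≤ n h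
  sum≤-split⁻ n {g = g} {h} f≡g-h = trans (sum≤-split n f≡g-h) (cong (_+_ (sum≤ n g)) (sum≤-neg n h))

  -- Binomial transforms and exponential generating functions

  -1^_ : ℕ → ℤ
  -1^ zero  = 1ℤ
  -1^ suc n = - -1^ n

  -1^-even : ∀ n → 2 ℕ.∣ n → -1^ n ≡ 1ℤ
  -1^-even n (ℕ.divides q refl) = even q
    where
    even : ∀ q → -1^ (q ℕ.* 2) ≡ 1ℤ
    even zero    = refl
    even (suc q) = trans (ℤ.neg-involutive (-1^ (q ℕ.* 2))) (even q)

  -- If U(z) = Σ u n zⁿ/n! is the EGF of u, then shift u, u ↑ j, binomial u, binomial⁻ u, δ₀ and
  -- u ⋆ w are the sequences with EGFs U′(z), U⁽ʲ⁾(z), e^z U(z), e^(-z) U(z), 1 and U(z) W(z).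
  shift : (ℕ → ℤ) → ℕ → ℤ
  shift u n = u (suc n)

  infixl 8 _↑_
  _↑_ : (ℕ → ℤ) → ℕ → ℕ → ℤ
  (u ↑ j) i = u (i ℕ.+ j)

  binomial : (ℕ → ℤ) → ℕ → ℤ
  binomial u n = ∑[ i ≤ n ] (+ (n C i) * u i)

  binomial⁻ : (ℕ → ℤ) → ℕ → ℤ
  binomial⁻ u n = ∑[ i ≤ n ] (+ (n C i) * (-1^ (n ∸ i) * u i))

  δ₀ : ℕ → ℤ
  δ₀ zero    = 1ℤ
  δ₀ (suc _) = 0ℤ

  infixl 7 _⋆_
  _⋆_ : (ℕ → ℤ) → (ℕ → ℤ) → ℕ → ℤ
  (u ⋆ w) n = ∑[ i ≤ n ] (+ (n C i) * (u i * w (n ∸ i)))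

  sum≤-pascal : ∀ n (X : ℕ → ℤ) → ∑[ i ≤ suc n ] (+ (suc n C i) * X i)
                      ≡ ∑[ i ≤ n ] (+ (n C i) * X (suc i)) + ∑[ i ≤ n ] (+ (n C i) * X i)
  sum≤-pascal n X = begin
    F 0 + ∑[ i ≤ n ] (+ (suc n C suc i) * X (suc i)) ≡⟨ cong (_+_ (F 0)) (sum≤-split n pascal) ⟩
    F 0 + (S + sum≤ n (F ∘ suc))                    ≡⟨ x∙yz≈y∙xz (F 0) S (sum≤ n (F ∘ suc)) ⟩
    S + sum≤ (suc n) F                              ≡⟨ cong (_+_ S) (sum≤-suc n F) ⟩
    S + (sum≤ n F + F (suc n))                      ≡⟨ cong (λ t → S + (sum≤ n F + t)) F[1+n]≡0 ⟩
    S + (sum≤ n F + 0ℤ)                             ≡⟨ cong (_+_ S) (ℤ.+-identityʳ (sum≤ n F)) ⟩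
    S + sum≤ n F                                    ∎
    where
    open ≡-Reasoning
    F : ℕ → ℤ
    F i = + (n C i) * X i
    S : ℤ
    S = ∑[ i ≤ n ] (+ (n C i) * X (suc i))
    pascal : ∀ i → + (suc n C suc i) * X (suc i) ≡ + (n C i) * X (suc i) + F (suc i)
    pascal i = begin
      + (suc n C suc i) * X (suc i)        ≡⟨ cong (λ c → + c * X (suc i)) (nCk+nC[k+1]≡[n+1]C[k+1] n i) ⟨
      + (n C i ℕ.+ n C suc i) * X (suc i)  ≡⟨ ℤ.*-distribʳ-+ (X (suc i)) (+ (n C i)) (+ (n C suc i)) ⟩
      + (n C i) * X (suc i) + F (suc i)    ∎
    F[1+n]≡0 : F (suc n) ≡ 0ℤ
    F[1+n]≡0 = trans (cong (λ c → + c * X (suc n)) (k>n⇒nCk≡0 (ℕ.n<1+n n))) (ℤ.*-zeroˡ (X (suc n)))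

  binomial-suc : ∀ (u : ℕ → ℤ) n → binomial u (suc n) ≡ binomial (shift u) n + binomial u n
  binomial-suc u n = sum≤-pascal n u

  binomial⁻-suc : ∀ (u : ℕ → ℤ) n → binomial⁻ u (suc n) ≡ binomial⁻ (shift u) n - binomial⁻ u n
  binomial⁻-suc u n = trans (sum≤-pascal n (λ i → -1^ (suc n ∸ i) * u i))
                            (cong (_+_ (binomial⁻ (shift u) n)) (trans (sum≤-cong n flip-sign) (sum≤-neg n _)))
    where
    flip-sign : ∀ i → i ≤ n → + (n C i) * (-1^ (suc n ∸ i) * u i) ≡ - (+ (n C i) * (-1^ (n ∸ i) * u i))
    flip-sign i i≤n = begin
      + (n C i) * (-1^ (suc n ∸ i) * u i)    ≡⟨ cong (λ k → + (n C i) * (-1^ k * u i)) (ℕ.+-∸-assoc 1 i≤n) ⟩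
      + (n C i) * (- -1^ (n ∸ i) * u i)      ≡⟨ sign-out (+ (n C i)) (-1^ (n ∸ i)) (u i) ⟩
      - (+ (n C i) * (-1^ (n ∸ i) * u i))    ∎
      where
      open ≡-Reasoning
      sign-out : ∀ a s x → a * (- s * x) ≡ - (a * (s * x))
      sign-out = solve-∀

  ⋆-suc : ∀ (u w : ℕ → ℤ) n → (u ⋆ w) (suc n) ≡ (shift u ⋆ w) n + (u ⋆ shift w) n
  ⋆-suc u w n = trans (sum≤-pascal n (λ i → u i * w (suc n ∸ i)))
                      (cong (_+_ ((shift u ⋆ w) n)) (sum≤-cong n shift-w))
    where
    shift-w : ∀ i → i ≤ n → + (n C i) * (u i * w (suc n ∸ i)) ≡ + (n C i) * (u i * shift w (n ∸ i))
    shift-w i i≤n = cong (λ k → + (n C i) * (u i * w k)) (ℕ.+-∸-assoc 1 i≤n)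

  binomial-cong : ∀ {u v : ℕ → ℤ} → (∀ i → u i ≡ v i) → ∀ n → binomial u n ≡ binomial v n
  binomial-cong u≡v n = sum≤-cong n (λ i _ → cong (_*_ (+ (n C i))) (u≡v i))

  binomial⁻-cong : ∀ {u v : ℕ → ℤ} → (∀ i → u i ≡ v i) → ∀ n → binomial⁻ u n ≡ binomial⁻ v n
  binomial⁻-cong u≡v n = sum≤-cong n (λ i _ → cong (λ x → + (n C i) * (-1^ (n ∸ i) * x)) (u≡v i))

  binomial⁻-split : ∀ {u v w : ℕ → ℤ} → (∀ i → u i ≡ v i + w i) →
                    ∀ n → binomial⁻ u n ≡ binomial⁻ v n + binomial⁻ w n
  binomial⁻-split {u} {v} {w} u≡v+w n = sum≤-split n λ i →
    trans (cong (λ x → + (n C i) * (-1^ (n ∸ i) * x)) (u≡v+w i)) (distrib (+ (n C i)) (-1^ (n ∸ i)) (v i) (w i))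
    where
    distrib : ∀ c s x y → c * (s * (x + y)) ≡ c * (s * x) + c * (s * y)
    distrib = solve-∀

  ⋆-splitʳ : ∀ {u w w₁ w₂ : ℕ → ℤ} → (∀ i → w i ≡ w₁ i + w₂ i) →
             ∀ n → (u ⋆ w) n ≡ (u ⋆ w₁) n + (u ⋆ w₂) n
  ⋆-splitʳ {u} {w} {w₁} {w₂} w≡w₁+w₂ n = sum≤-split n λ i →
    trans (cong (λ x → + (n C i) * (u i * x)) (w≡w₁+w₂ (n ∸ i))) (distrib (+ (n C i)) (u i) (w₁ (n ∸ i)) (w₂ (n ∸ i)))
    where
    distrib : ∀ c x y z → c * (x * (y + z)) ≡ c * (x * y) + c * (x * z)
    distrib = solve-∀

  ⋆-split⁻ˡ : ∀ {u u₁ u₂ w : ℕ → ℤ} → (∀ i → u i ≡ u₁ i - u₂ i) →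
              ∀ n → (u ⋆ w) n ≡ (u₁ ⋆ w) n - (u₂ ⋆ w) n
  ⋆-split⁻ˡ {u} {u₁} {u₂} {w} u≡u₁-u₂ n = sum≤-split⁻ n λ i →
    trans (cong (λ x → + (n C i) * (x * w (n ∸ i))) (u≡u₁-u₂ i)) (distrib (+ (n C i)) (u₁ i) (u₂ i) (w (n ∸ i)))
    where
    distrib : ∀ c x y z → c * ((x - y) * z) ≡ c * (x * z) - c * (y * z)
    distrib = solve-∀

  binomial⁻-inverseˡ : ∀ n (u : ℕ → ℤ) → binomial⁻ (binomial u) n ≡ u n
  binomial⁻-inverseˡ zero    u = trans (ℤ.*-identityˡ _) (trans (ℤ.*-identityˡ _) (ℤ.*-identityˡ (u 0)))
  binomial⁻-inverseˡ (suc n) u = begin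
    binomial⁻ (binomial u) (suc n)                   ≡⟨ binomial⁻-suc (binomial u) n ⟩
    binomial⁻ (shift (binomial u)) n - B⁻B u
      ≡⟨ cong (_- B⁻B u) (binomial⁻-split {v = binomial (shift u)} {binomial u} (binomial-suc u) n) ⟩
    (B⁻B (shift u) + B⁻B u) - B⁻B u                  ≡⟨ cancel (B⁻B (shift u)) (B⁻B u) ⟩
    B⁻B (shift u)                                    ≡⟨ binomial⁻-inverseˡ n (shift u) ⟩
    u (suc n)                                        ∎
    where
    open ≡-Reasoning
    B⁻B : (ℕ → ℤ) → ℤ
    B⁻B v = binomial⁻ (binomial v) n
    cancel : ∀ a b → (a + b) - b ≡ a
    cancel = solve-∀

  binomial⁻⋆binomial : ∀ n (u w : ℕ → ℤ) → (binomial⁻ u ⋆ binomial w) n ≡ (u ⋆ w) n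
  binomial⁻⋆binomial zero    u w = units (u 0) (w 0)
    where
    units : ∀ a b → 1ℤ * (1ℤ * (1ℤ * a) * (1ℤ * b)) ≡ 1ℤ * (a * b)
    units = solve-∀
  binomial⁻⋆binomial (suc n) u w = begin
    (binomial⁻ u ⋆ binomial w) (suc n)
      ≡⟨ ⋆-suc (binomial⁻ u) (binomial w) n ⟩
    (shift (binomial⁻ u) ⋆ binomial w) n + (binomial⁻ u ⋆ shift (binomial w)) n
      ≡⟨ cong₂ _+_ (⋆-split⁻ˡ {u₁ = binomial⁻ (shift u)} {binomial⁻ u} {binomial w} (binomial⁻-suc u) n)
                     (⋆-splitʳ {binomial⁻ u} {w₁ = binomial (shift w)} {binomial w} (binomial-suc w) n) ⟩
    (a - b) + (c + b)
      ≡⟨ cancel a b c ⟩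
    a + c
      ≡⟨ cong₂ _+_ (binomial⁻⋆binomial n (shift u) w) (binomial⁻⋆binomial n u (shift w)) ⟩
    (shift u ⋆ w) n + (u ⋆ shift w) n
      ≡⟨ ⋆-suc u w n ⟨
    (u ⋆ w) (suc n) ∎
    where
    open ≡-Reasoning
    a b c : ℤ
    a = (binomial⁻ (shift u) ⋆ binomial w) n
    b = (binomial⁻ u ⋆ binomial w) n
    c = (binomial⁻ u ⋆ binomial (shift w)) n
    cancel : ∀ a b c → (a - b) + (c + b) ≡ a + c
    cancel = solve-∀

  binomial⁻-binomial-↑ : ∀ M j (u : ℕ → ℤ) → binomial⁻ (binomial u ↑ j) M ≡ binomial (u ↑ M) j
  binomial⁻-binomial-↑ zero j u =
    trans (trans (ℤ.*-identityˡ _) (ℤ.*-identityˡ _)) (binomial-cong (λ i → cong u (sym (ℕ.+-identityʳ i))) j)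
  binomial⁻-binomial-↑ (suc M) j u = begin
    binomial⁻ (binomial u ↑ j) (suc M)
      ≡⟨ binomial⁻-suc (binomial u ↑ j) M ⟩
    binomial⁻ (shift (binomial u ↑ j)) M - binomial⁻ (binomial u ↑ j) M
      ≡⟨ cong (_- binomial⁻ (binomial u ↑ j) M) (binomial⁻-cong (λ i → cong (binomial u) (sym (ℕ.+-suc i j))) M) ⟩
    binomial⁻ (binomial u ↑ suc j) M - binomial⁻ (binomial u ↑ j) M
      ≡⟨ cong₂ _-_ (binomial⁻-binomial-↑ M (suc j) u) (binomial⁻-binomial-↑ M j u) ⟩
    binomial (u ↑ M) (suc j) - binomial (u ↑ M) j
      ≡⟨ cong (_- binomial (u ↑ M) j) (binomial-suc (u ↑ M) j) ⟩
    (binomial (shift (u ↑ M)) j + binomial (u ↑ M) j) - binomial (u ↑ M) j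
      ≡⟨ cancel (binomial (shift (u ↑ M)) j) (binomial (u ↑ M) j) ⟩
    binomial (shift (u ↑ M)) j
      ≡⟨ binomial-cong (λ i → cong u (sym (ℕ.+-suc i M))) j ⟩
    binomial (u ↑ suc M) j ∎
    where
    open ≡-Reasoning
    cancel : ∀ a b → (a + b) - b ≡ a
    cancel = solve-∀

  -- For 3-periodic u, V = e^(-z) U(z) satisfies (D + 1)³ V = e^(-z) U‴ = V, i.e. V‴ + 3V″ + 3V′ = 0.
  binomial⁻-periodic₃ : ∀ {u : ℕ → ℤ} → (∀ i → u (3 ℕ.+ i) ≡ u i) →
                        ∀ n → binomial⁻ u (3 ℕ.+ n) ≡ - (+ 3 * binomial⁻ u (2 ℕ.+ n) + + 3 * binomial⁻ u (1 ℕ.+ n))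
  binomial⁻-periodic₃ {u} u-periodic n = begin
    binomial⁻ u (3 ℕ.+ n)
      ≡⟨ binomial⁻-suc u (2 ℕ.+ n) ⟩
    binomial⁻ (shift u) (2 ℕ.+ n) - binomial⁻ u (2 ℕ.+ n)
      ≡⟨ cong₂ _-_ (trans (expand₂ (shift u)) (cong (λ d → (d - c) - (c - b)) (binomial⁻-cong u-periodic n))) (expand₂ u) ⟩
    ((a - c) - (c - b)) - ((c - b) - (b - a))
      ≡⟨ third-difference a b c ⟩
    - (+ 3 * ((c - b) - (b - a)) + + 3 * (b - a))
      ≡⟨ cong₂ (λ x y → - (+ 3 * x + + 3 * y)) (expand₂ u) (binomial⁻-suc u n) ⟨
    - (+ 3 * binomial⁻ u (2 ℕ.+ n) + + 3 * binomial⁻ u (1 ℕ.+ n)) ∎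
    where
    open ≡-Reasoning
    D : (ℕ → ℤ) → ℤ
    D v = binomial⁻ v n
    a b c : ℤ
    a = D u
    b = D (shift u)
    c = D (shift (shift u))
    expand₂ : ∀ v → binomial⁻ v (2 ℕ.+ n) ≡ (D (shift (shift v)) - D (shift v)) - (D (shift v) - D v)
    expand₂ v = trans (binomial⁻-suc v (suc n)) (cong₂ _-_ (binomial⁻-suc (shift v) n) (binomial⁻-suc v n))
    third-difference : ∀ a b c → ((a - c) - (c - b)) - ((c - b) - (b - a)) ≡ - (+ 3 * ((c - b) - (b - a)) + + 3 * (b - a))
    third-difference = solve-∀

  nCk*[k!*[n∸k]!]≡n! : ∀ {n k} → k ≤ n → (n C k) ℕ.* (k ! ℕ.* (n ∸ k) !) ≡ n !
  nCk*[k!*[n∸k]!]≡n! {n} {k} k≤n = trans (cong (ℕ._* (k ! ℕ.* (n ∸ k) !)) (nCk≡n!/k![n-k]! k≤n))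
                                         (m/n*n≡m (k![n∸k]!∣n! k≤n))
    where instance _ = k !* (n ∸ k) !≢0

  [1+k]*[1+n]C[1+k]≡[1+n]*nCk : ∀ n k → suc k ℕ.* (suc n C suc k) ≡ suc n ℕ.* (n C k)
  [1+k]*[1+n]C[1+k]≡[1+n]*nCk n k with k ℕ.≤? n
  ... | yes k≤n = ℕ.*-cancelʳ-≡ _ _ (k ! ℕ.* (n ∸ k) !) {{k !* (n ∸ k) !≢0}} (begin
    suc k ℕ.* (suc n C suc k) ℕ.* (k ! ℕ.* (n ∸ k) !)
      ≡⟨ rearrange (suc k) (suc n C suc k) (k !) ((n ∸ k) !) ⟩
    (suc n C suc k) ℕ.* (suc k ℕ.* k ! ℕ.* (n ∸ k) !)
      ≡⟨ nCk*[k!*[n∸k]!]≡n! (s≤s k≤n) ⟩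
    suc n !
      ≡⟨ cong (suc n ℕ.*_) (nCk*[k!*[n∸k]!]≡n! k≤n) ⟨
    suc n ℕ.* ((n C k) ℕ.* (k ! ℕ.* (n ∸ k) !))
      ≡⟨ ℕ.*-assoc (suc n) (n C k) _ ⟨
    suc n ℕ.* (n C k) ℕ.* (k ! ℕ.* (n ∸ k) !) ∎)
    where
    open ≡-Reasoning
    rearrange : ∀ a b c d → a ℕ.* b ℕ.* (c ℕ.* d) ≡ b ℕ.* (a ℕ.* c ℕ.* d)
    rearrange = ℕ-Solver.solve-∀
  ... | no k≰n = begin
    suc k ℕ.* (suc n C suc k)  ≡⟨ cong (suc k ℕ.*_) (k>n⇒nCk≡0 (s≤s n<k)) ⟩
    suc k ℕ.* 0                ≡⟨ ℕ.*-zeroʳ (suc k) ⟩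
    0                          ≡⟨ ℕ.*-zeroʳ (suc n) ⟨
    suc n ℕ.* 0                ≡⟨ cong (suc n ℕ.*_) (k>n⇒nCk≡0 n<k) ⟨
    suc n ℕ.* (n C k)          ∎
    where
    open ≡-Reasoning
    n<k = ℕ.≰⇒> k≰n

  -- Divisibility in ℤ₍ₚ₎

  1∣ : ∀ x → 1ℤ ∣ x
  1∣ x = divides x (sym (ℤ.*-identityʳ x))

  *-pres-∣ : ∀ {a b c d} → a ∣ b → c ∣ d → a * c ∣ b * d
  *-pres-∣ {b = b} {c} a∣b c∣d = ∣-trans (*-monoˡ-∣ c a∣b) (*-monoʳ-∣ b c∣d)

  module LocalDivisibility {p : ℕ} (p-prime : Prime p) where

    private instance
      p≢0 : ℕ.NonZero p
      p≢0 = prime⇒nonZero p-prime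

    p∤1 : ¬ (+ p ∣ 1ℤ)
    p∤1 p∣1 = ¬prime[1] (subst Prime (ℕ.∣1⇒≡1 (∣⇒∣ᵤ p∣1)) p-prime)

    euclidsLemmaℤ : ∀ a b → + p ∣ a * b → + p ∣ a ⊎ + p ∣ b
    euclidsLemmaℤ a b p∣ab =
      Sum.map ∣ᵤ⇒∣ ∣ᵤ⇒∣ (euclidsLemma ℤ.∣ a ∣ ℤ.∣ b ∣ p-prime (subst (p ℕ.∣_) (ℤ.abs-* a b) (∣⇒∣ᵤ p∣ab)))

    ∤-* : ∀ {a b} → ¬ (+ p ∣ a) → ¬ (+ p ∣ b) → ¬ (+ p ∣ a * b)
    ∤-* {a} {b} p∤a p∤b p∣ab = [ p∤a , p∤b ] (euclidsLemmaℤ a b p∣ab)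

    p^e∣-cancelˡ : ∀ e {k y} → ¬ (+ p ∣ k) → + (p ^ e) ∣ k * y → + (p ^ e) ∣ y
    p^e∣-cancelˡ zero    {y = y} _   _ = 1∣ y
    p^e∣-cancelˡ (suc e) {k} {y} p∤k p^[1+e]∣ky
      with euclidsLemmaℤ k y (∣-trans (∣ᵤ⇒∣ (ℕ.m∣m*n (p ^ e))) p^[1+e]∣ky)
    ... | inj₁ p∣k = contradiction p∣k p∤k
    ... | inj₂ (divides q refl) = subst (_∣ q * + p) (sym (ℤ.pos-* p (p ^ e))) p*p^e∣q*p
      where
      p*p^e∣p*kq : + p * + (p ^ e) ∣ + p * (k * q)
      p*p^e∣p*kq = subst₂ _∣_ (ℤ.pos-* p (p ^ e)) (reassoc k q (+ p)) p^[1+e]∣ky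
        where
        reassoc : ∀ k q p → k * (q * p) ≡ p * (k * q)
        reassoc = solve-∀
      p*p^e∣q*p : + p * + (p ^ e) ∣ q * + p
      p*p^e∣q*p = subst (_ ∣_) (ℤ.*-comm (+ p) q) (*-monoʳ-∣ (+ p) (p^e∣-cancelˡ e p∤k (*-cancelˡ-∣ (+ p) p*p^e∣p*kq)))

    -- x divides y in the localisation ℤ₍ₚ₎, i.e. y / x has no p in its denominator.
    infix 4 _∣ₚ_
    record _∣ₚ_ (x y : ℤ) : Set where
      constructor mk∣ₚ
      field
        unit   : ℤ
        p∤unit : ¬ (+ p ∣ unit)
        ∣unit* : x ∣ unit * y

    ∣⇒∣ₚ : ∀ {x y} → x ∣ y → x ∣ₚ y
    ∣⇒∣ₚ {x} {y} x∣y = mk∣ₚ 1ℤ p∤1 (subst (x ∣_) (sym (ℤ.*-identityˡ y)) x∣y)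

    ≡unit*⇒∣ₚ : ∀ {x y u} → ¬ (+ p ∣ u) → x ≡ u * y → x ∣ₚ y
    ≡unit*⇒∣ₚ {u = u} p∤u refl = mk∣ₚ u p∤u ∣-refl

    ∣ₚ-trans : ∀ {x y z} → x ∣ₚ y → y ∣ₚ z → x ∣ₚ z
    ∣ₚ-trans {x} {y} {z} (mk∣ₚ k p∤k x∣ky) (mk∣ₚ l p∤l y∣lz) =
      mk∣ₚ (k * l) (∤-* p∤k p∤l) (subst (x ∣_) (sym (ℤ.*-assoc k l z)) (∣-trans x∣ky (*-monoʳ-∣ k y∣lz)))

    ∣-∣ₚ-trans : ∀ {x y z} → x ∣ y → y ∣ₚ z → x ∣ₚ z
    ∣-∣ₚ-trans x∣y = ∣ₚ-trans (∣⇒∣ₚ x∣y)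

    ∣ₚ-∣-trans : ∀ {x y z} → x ∣ₚ y → y ∣ z → x ∣ₚ z
    ∣ₚ-∣-trans x∣ₚy y∣z = ∣ₚ-trans x∣ₚy (∣⇒∣ₚ y∣z)

    p^e∣-∣ₚ-trans : ∀ e {x y} → + (p ^ e) ∣ x → x ∣ₚ y → + (p ^ e) ∣ y
    p^e∣-∣ₚ-trans e p^e∣x (mk∣ₚ k p∤k x∣ky) = p^e∣-cancelˡ e p∤k (∣-trans p^e∣x x∣ky)

    ∣ₚ-+ : ∀ {x y z} → x ∣ₚ y → x ∣ₚ z → x ∣ₚ y + z
    ∣ₚ-+ {x} {y} {z} (mk∣ₚ k p∤k x∣ky) (mk∣ₚ l p∤l x∣lz) =
      mk∣ₚ (k * l) (∤-* p∤k p∤l)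
           (subst (x ∣_) (distrib k l y z) (∣m∣n⇒∣m+n (∣n⇒∣m*n l x∣ky) (∣n⇒∣m*n k x∣lz)))
      where
      distrib : ∀ k l y z → l * (k * y) + k * (l * z) ≡ k * l * (y + z)
      distrib = solve-∀

    ∣ₚ-*ˡ : ∀ {x y} a → x ∣ₚ y → x ∣ₚ a * y
    ∣ₚ-*ˡ {x} {y} a (mk∣ₚ k p∤k x∣ky) = mk∣ₚ k p∤k (subst (x ∣_) (swap a k y) (∣n⇒∣m*n a x∣ky))
      where
      swap : ∀ a k y → a * (k * y) ≡ k * (a * y)
      swap = solve-∀

    ∣ₚ-neg : ∀ {x y} → x ∣ₚ y → x ∣ₚ - y
    ∣ₚ-neg {x} {y} x∣ₚy = subst (x ∣ₚ_) (ℤ.-1*i≡-i y) (∣ₚ-*ˡ (- 1ℤ) x∣ₚy)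

    *-pres-∣ₚ : ∀ {x₁ y₁ x₂ y₂} → x₁ ∣ₚ y₁ → x₂ ∣ₚ y₂ → x₁ * x₂ ∣ₚ y₁ * y₂
    *-pres-∣ₚ {x₁} {y₁} {x₂} {y₂} (mk∣ₚ k p∤k x₁∣ky₁) (mk∣ₚ l p∤l x₂∣ly₂) =
      mk∣ₚ (k * l) (∤-* p∤k p∤l) (subst (x₁ * x₂ ∣_) (transpose k y₁ l y₂) (*-pres-∣ x₁∣ky₁ x₂∣ly₂))
      where
      transpose : ∀ k y l z → k * y * (l * z) ≡ k * l * (y * z)
      transpose = solve-∀

    ∣ₚ-sum≤ : ∀ n {x f} → (∀ i → i ≤ n → x ∣ₚ f i) → x ∣ₚ sum≤ n f
    ∣ₚ-sum≤ n {x} = sum≤-closed (x ∣ₚ_) ∣ₚ-+ n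

    -- Σ u n zⁿ/n! lies in ℤ₍ₚ₎[[z]].
    IntegralEGF : (ℕ → ℤ) → Set
    IntegralEGF u = ∀ n → + (n !) ∣ₚ u n

    ⋆-inverse-integral : ∀ {u w : ℕ → ℤ} → u 0 ≡ 1ℤ → (∀ n → (u ⋆ w) n ≡ δ₀ n) →
                         IntegralEGF u → IntegralEGF w
    ⋆-inverse-integral {u} {w} u₀≡1 u⋆w≡δ₀ u-integral = <-rec _ bound
      where
      bound : ∀ n → (∀ {m} → m < n → + (m !) ∣ₚ w m) → + (n !) ∣ₚ w n
      bound zero    _   = ∣⇒∣ₚ (1∣ (w 0))
      bound (suc n) rec = subst (+ (suc n !) ∣ₚ_) (sym w[1+n]) (∣ₚ-neg (∣ₚ-sum≤ n term))
        where
        S : ℤ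
        S = ∑[ i ≤ n ] (+ (suc n C suc i) * (u (suc i) * w (n ∸ i)))
        w[1+n] : w (suc n) ≡ - S
        w[1+n] = inverseˡ-unique (w (suc n)) S (begin
          w (suc n) + S                 ≡⟨ cong (_+ S) (ℤ.*-identityˡ (w (suc n))) ⟨
          1ℤ * w (suc n) + S            ≡⟨ cong (λ a → a * w (suc n) + S) u₀≡1 ⟨
          u 0 * w (suc n) + S           ≡⟨ cong (_+ S) (ℤ.*-identityˡ (u 0 * w (suc n))) ⟨
          1ℤ * (u 0 * w (suc n)) + S    ≡⟨ u⋆w≡δ₀ (suc n) ⟩
          0ℤ                            ∎)
          where open ≡-Reasoning
        term : ∀ i → i ≤ n → + (suc n !) ∣ₚ + (suc n C suc i) * (u (suc i) * w (n ∸ i))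
        term i i≤n = subst (_∣ₚ + (suc n C suc i) * (u (suc i) * w (n ∸ i))) factorials
          (*-pres-∣ₚ {x₁ = + (suc n C suc i)} (∣⇒∣ₚ ∣-refl)
                     (*-pres-∣ₚ (u-integral (suc i)) (rec (s≤s (ℕ.m∸n≤m n i)))))
          where
          factorials : + (suc n C suc i) * (+ (suc i !) * + ((n ∸ i) !)) ≡ + (suc n !)
          factorials = trans (cong (+ (suc n C suc i) *_) (sym (ℤ.pos-* (suc i !) _)))
                             (trans (sym (ℤ.pos-* (suc n C suc i) _)) (cong +_ (nCk*[k!*[n∸k]!]≡n! (s≤s i≤n))))

    j!∣ₚbinomial⁻[u↑j] : ∀ {u} → IntegralEGF u → ∀ j M → + (j !) ∣ₚ binomial⁻ (u ↑ j) M
    j!∣ₚbinomial⁻[u↑j] u-integral j M = ∣ₚ-sum≤ M λ i _ →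
      ∣ₚ-*ˡ (+ (M C i)) (∣ₚ-*ˡ (-1^ (M ∸ i))
        (∣-∣ₚ-trans (∣ᵤ⇒∣ (ℕ.m≤n⇒m!∣n! (ℕ.m≤n+m j i))) (u-integral (i ℕ.+ j))))

  -- 3-adic estimates

  prime[3] : Prime 3
  prime[3] = from-yes (prime? 3)

  open LocalDivisibility prime[3]

  ^-monoʳ-∣ : ∀ m {a b} → a ≤ b → m ^ a ℕ.∣ m ^ b
  ^-monoʳ-∣ m {a} {b} a≤b = ℕ.divides (m ^ (b ∸ a)) (begin
    m ^ b                 ≡⟨ cong (m ^_) (ℕ.m∸n+n≡m a≤b) ⟨
    m ^ (b ∸ a ℕ.+ a)     ≡⟨ ℕ.^-distribˡ-+-* m (b ∸ a) a ⟩
    m ^ (b ∸ a) ℕ.* m ^ a ∎)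
    where open ≡-Reasoning

  3∤1 : 3 ℕ.∤ 1
  3∤1 = from-no (3 ℕ.∣? 1)

  3∤2 : 3 ℕ.∤ 2
  3∤2 = from-no (3 ℕ.∣? 2)

  3∤-* : ∀ {a b} → 3 ℕ.∤ a → 3 ℕ.∤ b → 3 ℕ.∤ a ℕ.* b
  3∤-* {a} {b} 3∤a 3∤b 3∣ab = [ 3∤a , 3∤b ] (euclidsLemma a b prime[3] 3∣ab)

  ∤m∣n⇒∤m+n : ∀ {d m n} → d ℕ.∤ m → d ℕ.∣ n → d ℕ.∤ m ℕ.+ n
  ∤m∣n⇒∤m+n {d} {m} {n} d∤m d∣n d∣m+n = d∤m (ℕ.∣m+n∣m⇒∣n (subst (d ℕ.∣_) (ℕ.+-comm m n) d∣m+n) d∣n)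

  3∤r+q*3 : ∀ {r} q → 3 ℕ.∤ r → 3 ℕ.∤ r ℕ.+ q ℕ.* 3
  3∤r+q*3 q 3∤r = ∤m∣n⇒∤m+n 3∤r (ℕ.n∣m*n q)

  [3q]!-factorisation : ∀ q → ∃[ R ] (3 ℕ.∤ R × (q ℕ.* 3) ! ≡ R ℕ.* (3 ^ q ℕ.* q !))
  [3q]!-factorisation zero = 1 , 3∤1 , refl
  [3q]!-factorisation (suc q) =
    let R , 3∤R , eq = [3q]!-factorisation q
        m = q ℕ.* 3
    in (2 ℕ.+ m) ℕ.* ((1 ℕ.+ m) ℕ.* R) ,
       3∤-* (3∤r+q*3 q 3∤2) (3∤-* (3∤r+q*3 q 3∤1) 3∤R) ,
       trans (cong (λ x → (3 ℕ.+ m) ℕ.* ((2 ℕ.+ m) ℕ.* ((1 ℕ.+ m) ℕ.* x))) eq) (rearrange q (3 ^ q) (q !) R)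
    where
    rearrange : ∀ q P F R → (3 ℕ.+ q ℕ.* 3) ℕ.* ((2 ℕ.+ q ℕ.* 3) ℕ.* ((1 ℕ.+ q ℕ.* 3) ℕ.* (R ℕ.* (P ℕ.* F))))
                          ≡ (2 ℕ.+ q ℕ.* 3) ℕ.* ((1 ℕ.+ q ℕ.* 3) ℕ.* R) ℕ.* (3 ℕ.* P ℕ.* (F ℕ.+ q ℕ.* F))
    rearrange = ℕ-Solver.solve-∀

  [r+3q]!-factorisation : ∀ q r → r < 3 → ∃[ R ] (3 ℕ.∤ R × (r ℕ.+ q ℕ.* 3) ! ≡ R ℕ.* (3 ^ q ℕ.* q !))
  [r+3q]!-factorisation q 0 _ = [3q]!-factorisation q
  [r+3q]!-factorisation q 1 _ =
    let R , 3∤R , eq = [3q]!-factorisation q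
    in (1 ℕ.+ q ℕ.* 3) ℕ.* R , 3∤-* (3∤r+q*3 q 3∤1) 3∤R ,
       trans (cong ((1 ℕ.+ q ℕ.* 3) ℕ.*_) eq) (sym (ℕ.*-assoc (1 ℕ.+ q ℕ.* 3) R _))
  [r+3q]!-factorisation q 2 _ =
    let R , 3∤R , eq = [3q]!-factorisation q
    in (2 ℕ.+ q ℕ.* 3) ℕ.* ((1 ℕ.+ q ℕ.* 3) ℕ.* R) , 3∤-* (3∤r+q*3 q 3∤2) (3∤-* (3∤r+q*3 q 3∤1) 3∤R) ,
       trans (cong (λ x → (2 ℕ.+ q ℕ.* 3) ℕ.* ((1 ℕ.+ q ℕ.* 3) ℕ.* x)) eq)
             (rearrange (2 ℕ.+ q ℕ.* 3) (1 ℕ.+ q ℕ.* 3) R _)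
    where
    rearrange : ∀ a b c d → a ℕ.* (b ℕ.* (c ℕ.* d)) ≡ a ℕ.* (b ℕ.* c) ℕ.* d
    rearrange = ℕ-Solver.solve-∀
  [r+3q]!-factorisation q (suc (suc (suc _))) (s≤s (s≤s (s≤s ())))

  ⌊3q/2⌋≡q+⌊q/2⌋ : ∀ q → ⌊ q ℕ.* 3 /2⌋ ≡ q ℕ.+ ⌊ q /2⌋
  ⌊3q/2⌋≡q+⌊q/2⌋ 0             = refl
  ⌊3q/2⌋≡q+⌊q/2⌋ 1             = refl
  ⌊3q/2⌋≡q+⌊q/2⌋ (suc (suc q)) =
    trans (cong (3 ℕ.+_) (⌊3q/2⌋≡q+⌊q/2⌋ q)) (cong (2 ℕ.+_) (sym (ℕ.+-suc q ⌊ q /2⌋)))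

  q+⌊[q-1]/2⌋≤⌊[r+3q-1]/2⌋ : ∀ q r → q ℕ.+ ⌊ pred q /2⌋ ≤ ⌊ pred (r ℕ.+ q ℕ.* 3) /2⌋
  q+⌊[q-1]/2⌋≤⌊[r+3q-1]/2⌋ q r =
    ℕ.≤-trans (ℕ.≤-reflexive (exact q)) (ℕ.⌊n/2⌋-mono (ℕ.pred-mono-≤ (ℕ.m≤n+m (q ℕ.* 3) r)))
    where
    exact : ∀ q → q ℕ.+ ⌊ pred q /2⌋ ≡ ⌊ pred (q ℕ.* 3) /2⌋
    exact zero    = refl
    exact (suc q) = cong suc (sym (⌊3q/2⌋≡q+⌊q/2⌋ q))

  n!∣ₚ3^⌊[n-1]/2⌋ : ∀ n → + (n !) ∣ₚ + (3 ^ ⌊ pred n /2⌋)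
  n!∣ₚ3^⌊[n-1]/2⌋ = <-rec P bound
    where
    P : ℕ → Set
    P n = + (n !) ∣ₚ + (3 ^ ⌊ pred n /2⌋)

    r+3q-case : ∀ q r → r < 3 → P q → P (r ℕ.+ q ℕ.* 3)
    r+3q-case q r r<3 Pq with [r+3q]!-factorisation q r r<3
    ... | R , 3∤R , eq = ∣ₚ-trans drop-unit (∣ₚ-∣-trans use-Pq exponent)
      where
      drop-unit : + ((r ℕ.+ q ℕ.* 3) !) ∣ₚ + (3 ^ q) * + (q !)
      drop-unit = ≡unit*⇒∣ₚ {u = + R} (3∤R ∘ ∣⇒∣ᵤ)
        (trans (cong +_ eq) (trans (ℤ.pos-* R _) (cong (+ R *_) (ℤ.pos-* (3 ^ q) (q !)))))
      use-Pq : + (3 ^ q) * + (q !) ∣ₚ + (3 ^ q) * + (3 ^ ⌊ pred q /2⌋)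
      use-Pq = *-pres-∣ₚ {x₁ = + (3 ^ q)} (∣⇒∣ₚ ∣-refl) Pq
      exponent : + (3 ^ q) * + (3 ^ ⌊ pred q /2⌋) ∣ + (3 ^ ⌊ pred (r ℕ.+ q ℕ.* 3) /2⌋)
      exponent = subst (_∣ + (3 ^ ⌊ pred (r ℕ.+ q ℕ.* 3) /2⌋)) (ℤ.pos-* (3 ^ q) (3 ^ ⌊ pred q /2⌋))
        (∣ᵤ⇒∣ (subst (ℕ._∣ 3 ^ ⌊ pred (r ℕ.+ q ℕ.* 3) /2⌋) (ℕ.^-distribˡ-+-* 3 q ⌊ pred q /2⌋)
                     (^-monoʳ-∣ 3 (q+⌊[q-1]/2⌋≤⌊[r+3q-1]/2⌋ q r))))

    bound : ∀ n → (∀ {m} → m < n → P m) → P n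
    bound zero    _   = ∣⇒∣ₚ ∣-refl
    bound n@(suc _) rec = subst P (sym (m≡m%n+[m/n]*n n 3))
                                (r+3q-case (n / 3) (n % 3) (m%n<n n 3) (rec (m/n<m n 3 (s≤s (s≤s z≤n)))))

  3^⌊[n-1]/2⌋∣ : ∀ {x : ℕ → ℤ} → (∀ n → x (3 ℕ.+ n) ≡ - (+ 3 * x (2 ℕ.+ n) + + 3 * x (1 ℕ.+ n))) →
                 ∀ n → + (3 ^ ⌊ pred n /2⌋) ∣ x n
  3^⌊[n-1]/2⌋∣ {x} x-rec zero    = 1∣ (x 0)
  3^⌊[n-1]/2⌋∣ {x} x-rec (suc n) = shifted n
    where
    shifted : ∀ n → + (3 ^ ⌊ n /2⌋) ∣ x (suc n)
    shifted 0             = 1∣ (x 1)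
    shifted 1             = 1∣ (x 2)
    shifted (suc (suc n)) = subst₂ _∣_ (sym (ℤ.pos-* 3 (3 ^ ⌊ n /2⌋))) (sym (x-rec n))
      (∣m⇒∣-m (∣m∣n⇒∣m+n (*-monoʳ-∣ (+ 3) (∣-trans 3^⌊n/2⌋∣3^⌊[1+n]/2⌋ (shifted (suc n))))
                         (*-monoʳ-∣ (+ 3) (shifted n))))
      where
      3^⌊n/2⌋∣3^⌊[1+n]/2⌋ : + (3 ^ ⌊ n /2⌋) ∣ + (3 ^ ⌊ suc n /2⌋)
      3^⌊n/2⌋∣3^⌊[1+n]/2⌋ = ∣ᵤ⇒∣ (^-monoʳ-∣ 3 (ℕ.⌊n/2⌋-mono (ℕ.n≤1+n n)))

  3∣3^[1+k] : ∀ k → 3 ℕ.∣ 3 ^ suc k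
  3∣3^[1+k] k = ℕ.m∣m*n (3 ^ k)

  3^[2+k]∣LC2-LC1 : ∀ k L → 3 ^ suc k ℕ.∣ L → + (3 ^ (2 ℕ.+ k)) ∣ + (L C 2) - + (L C 1)
  3^[2+k]∣LC2-LC1 k zero       _          = divides 0ℤ refl
  3^[2+k]∣LC2-LC1 k L@(suc L₁) 3^[1+k]∣L =
    p^e∣-cancelˡ (2 ℕ.+ k) {+ 2} (3∤2 ∘ ∣⇒∣ᵤ) (subst (_ ∣_) (sym 2[C2-C1]≡L[L-3]) 3^[2+k]∣L[L-3])
    where
    2[C2-C1]≡L[L-3] : + 2 * (+ (L C 2) - + (L C 1)) ≡ + L * (+ L - + 3)
    2[C2-C1]≡L[L-3] = begin
      + 2 * (+ (L C 2) - + (L C 1))      ≡⟨ cong (λ l → + 2 * (+ (L C 2) - + l)) (nC1≡n L) ⟩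
      + 2 * (+ (L C 2) - + L)            ≡⟨ distrib (+ (L C 2)) (+ L) ⟩
      + 2 * + (L C 2) - + 2 * + L        ≡⟨ cong (λ x → x - + 2 * + L) (ℤ.pos-* 2 (L C 2)) ⟨
      + (2 ℕ.* (L C 2)) - + 2 * + L      ≡⟨ cong (λ x → + x - + 2 * + L) absorption ⟩
      + (L ℕ.* L₁) - + 2 * + L           ≡⟨ cong (λ x → x - + 2 * + L) (ℤ.pos-* L L₁) ⟩
      + L * + L₁ - + 2 * + L             ≡⟨ factor (+ L₁) ⟩
      + L * (+ L - + 3)                  ∎
      where
      open ≡-Reasoning
      absorption : 2 ℕ.* (L C 2) ≡ L ℕ.* L₁
      absorption = trans ([1+k]*[1+n]C[1+k]≡[1+n]*nCk L₁ 1) (cong (L ℕ.*_) (nC1≡n L₁))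
      distrib : ∀ c l → + 2 * (c - l) ≡ + 2 * c - + 2 * l
      distrib = solve-∀
      factor : ∀ l₁ → (1ℤ + l₁) * l₁ - + 2 * (1ℤ + l₁) ≡ (1ℤ + l₁) * ((1ℤ + l₁) - + 3)
      factor = solve-∀
    3^[2+k]∣L[L-3] : + (3 ^ (2 ℕ.+ k)) ∣ + L * (+ L - + 3)
    3^[2+k]∣L[L-3] = subst (_∣ + L * (+ L - + 3)) (trans (ℤ.*-comm (+ (3 ^ suc k)) (+ 3)) (sym (ℤ.pos-* 3 (3 ^ suc k))))
      (*-pres-∣ {+ (3 ^ suc k)} {+ L} {+ 3} (∣ᵤ⇒∣ 3^[1+k]∣L)
                (∣m∣n⇒∣m-n {m = + L} (∣ᵤ⇒∣ (ℕ.∣-trans (3∣3^[1+k] k) 3^[1+k]∣L)) ∣-refl))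

  3^k∣LC3 : ∀ k L → 3 ^ suc k ℕ.∣ L → 3 ^ k ℕ.∣ L C 3
  3^k∣LC3 k zero       _          = (3 ^ k) ℕ.∣0
  3^k∣LC3 k (suc L₁) 3^[1+k]∣L =
    ℕ.*-cancelˡ-∣ 3 (subst (3 ^ suc k ℕ.∣_) (sym ([1+k]*[1+n]C[1+k]≡[1+n]*nCk L₁ 2))
                          (ℕ.∣m⇒∣m*n (L₁ C 2) 3^[1+k]∣L))

  3^[2+k]∣LC[1+j]*[1+j]! : ∀ k L j → 3 ^ suc k ℕ.∣ L → 3 ≤ j → 3 ^ (2 ℕ.+ k) ℕ.∣ (L C suc j) ℕ.* suc j !
  3^[2+k]∣LC[1+j]*[1+j]! k zero       j _          _   = (3 ^ (2 ℕ.+ k)) ℕ.∣0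
  3^[2+k]∣LC[1+j]*[1+j]! k L@(suc L₁) j 3^[1+k]∣L 3≤j =
    subst₂ ℕ._∣_ (ℕ.*-comm (3 ^ suc k) 3) (sym rearranged)
           (ℕ.*-pres-∣ 3^[1+k]∣L (ℕ.∣n⇒∣m*n (L₁ C j) (ℕ.∣-trans (ℕ.divides 2 refl) (ℕ.m≤n⇒m!∣n! 3≤j))))
    where
    rearranged : (L C suc j) ℕ.* suc j ! ≡ L ℕ.* ((L₁ C j) ℕ.* j !)
    rearranged = begin
      (L C suc j) ℕ.* (suc j ℕ.* j !)  ≡⟨ ℕ.*-assoc (L C suc j) (suc j) (j !) ⟨
      (L C suc j) ℕ.* suc j ℕ.* j !    ≡⟨ cong (ℕ._* j !) (ℕ.*-comm (L C suc j) (suc j)) ⟩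
      suc j ℕ.* (L C suc j) ℕ.* j !    ≡⟨ cong (ℕ._* j !) ([1+k]*[1+n]C[1+k]≡[1+n]*nCk L₁ j) ⟩
      L ℕ.* (L₁ C j) ℕ.* j !           ≡⟨ ℕ.*-assoc L (L₁ C j) (j !) ⟩
      L ℕ.* ((L₁ C j) ℕ.* j !)         ∎
      where open ≡-Reasoning

  3∣M⇒3∣MC2 : ∀ M → 3 ℕ.∣ M → 3 ℕ.∣ M C 2
  3∣M⇒3∣MC2 zero    _   = 3 ℕ.∣0
  3∣M⇒3∣MC2 (suc M) 3∣M = [ (λ 3∣2 → contradiction 3∣2 3∤2) , id ]′ (euclidsLemma 2 (suc M C 2) prime[3] 3∣2*MC2)
    where
    3∣2*MC2 : 3 ℕ.∣ 2 ℕ.* (suc M C 2)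
    3∣2*MC2 = subst (3 ℕ.∣_) (sym ([1+k]*[1+n]C[1+k]≡[1+n]*nCk M 1)) (ℕ.∣m⇒∣m*n (M C 1) 3∣M)

  9∣MC[1+i]*[1+i+3]! : ∀ M i → 3 ℕ.∣ M → 9 ℕ.∣ (M C suc i) ℕ.* (suc i ℕ.+ 3) !
  9∣MC[1+i]*[1+i+3]! M 0 3∣M =
    subst (λ c → 9 ℕ.∣ c ℕ.* 24) (sym (nC1≡n M)) (ℕ.*-pres-∣ {o = 3} {p = 3} 3∣M (ℕ.divides 8 refl))
  9∣MC[1+i]*[1+i+3]! M 1 3∣M = ℕ.*-pres-∣ {o = 3} {p = 3} (3∣M⇒3∣MC2 M 3∣M) (ℕ.divides 40 refl)
  9∣MC[1+i]*[1+i+3]! M (suc (suc i)) _ =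
    ℕ.∣n⇒∣m*n (M C suc (suc (suc i)))
              (ℕ.∣-trans (ℕ.divides 80 refl) (ℕ.m≤n⇒m!∣n! (s≤s (s≤s (s≤s (ℕ.m≤n+m 3 i))))))

  -- Lehmer numbers

  χ₃ : ℕ → ℤ
  χ₃ m = δ₀ (m % 3)

  χ₃≡0⊎3∣ : ∀ m → χ₃ m ≡ 0ℤ ⊎ 3 ℕ.∣ m
  χ₃≡0⊎3∣ m with m % 3 in m%3≡r
  ... | zero  = inj₂ (ℕ.m%n≡0⇒n∣m m 3 m%3≡r)
  ... | suc _ = inj₁ refl

  step-term≡ : ∀ n i w → step-term n i w ≡ + (suc n C suc i) * (χ₃ (suc i) * w)
  step-term≡ n i w with suc i % 3
  ... | zero  = cong (+ (suc n C suc i) *_) (sym (ℤ.*-identityˡ w))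
  ... | suc _ = sym (ℤ.*-zeroʳ (+ (suc n C suc i)))

  sumℤ-zipWith-Ws : ∀ (f : ℕ → ℤ → ℤ) n (h : ℕ → ℕ) →
                    sumℤ (zipWith f (applyUpTo h (suc n)) (Ws n)) ≡ ∑[ i ≤ n ] f (h i) (W (n ∸ i))
  sumℤ-zipWith-Ws f zero    h = ℤ.+-identityʳ (f (h 0) (W 0))
  sumℤ-zipWith-Ws f (suc n) h = cong (_+_ (f (h 0) (W (suc n)))) (sumℤ-zipWith-Ws f n (h ∘ suc))

  W-suc : ∀ n → W (suc n) ≡ - ∑[ i ≤ n ] (+ (suc n C suc i) * (χ₃ (suc i) * W (n ∸ i)))
  W-suc n = cong -_ (trans (sumℤ-zipWith-Ws (step-term n) n id) (sum≤-cong n (λ i _ → step-term≡ n i (W (n ∸ i)))))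

  χ₃⋆W≡δ₀ : ∀ n → (χ₃ ⋆ W) n ≡ δ₀ n
  χ₃⋆W≡δ₀ zero    = refl
  χ₃⋆W≡δ₀ (suc n) = begin
    1ℤ * (1ℤ * W (suc n)) + S  ≡⟨ cong (_+ S) (trans (ℤ.*-identityˡ (1ℤ * W (suc n))) (ℤ.*-identityˡ (W (suc n)))) ⟩
    W (suc n) + S              ≡⟨ cong (_+ S) (W-suc n) ⟩
    - S + S                    ≡⟨ ℤ.+-inverseˡ S ⟩
    0ℤ                         ∎
    where
    open ≡-Reasoning
    S : ℤ
    S = ∑[ i ≤ n ] (+ (suc n C suc i) * (χ₃ (suc i) * W (n ∸ i)))

  W-∤ : ∀ N → 3 ℕ.∤ N → W N ≡ 0ℤ
  W-∤ = <-rec _ vanish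
    where
    vanish : ∀ N → (∀ {m} → m < N → 3 ℕ.∤ m → W m ≡ 0ℤ) → 3 ℕ.∤ N → W N ≡ 0ℤ
    vanish zero    _   3∤0 = contradiction (3 ℕ.∣0) 3∤0
    vanish (suc n) rec 3∤N = trans (W-suc n) (cong -_ (sum≤-zero n term))
      where
      term : ∀ i → i ≤ n → + (suc n C suc i) * (χ₃ (suc i) * W (n ∸ i)) ≡ 0ℤ
      term i i≤n with χ₃≡0⊎3∣ (suc i)
      ... | inj₁ χ₃≡0 = trans (cong (λ c → + (suc n C suc i) * (c * W (n ∸ i))) χ₃≡0) (ℤ.*-zeroʳ (+ (suc n C suc i)))
      ... | inj₂ 3∣1+i = trans (cong (λ w → + (suc n C suc i) * (χ₃ (suc i) * w)) W[n∸i]≡0)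
                               (trans (cong (+ (suc n C suc i) *_) (ℤ.*-zeroʳ (χ₃ (suc i)))) (ℤ.*-zeroʳ (+ (suc n C suc i))))
        where
        W[n∸i]≡0 : W (n ∸ i) ≡ 0ℤ
        W[n∸i]≡0 = rec (s≤s (ℕ.m∸n≤m n i)) λ 3∣n∸i →
          3∤N (subst (3 ℕ.∣_) (ℕ.m+[n∸m]≡n (s≤s i≤n)) (ℕ.∣m∣n⇒∣m+n 3∣1+i 3∣n∸i))

  binomial⁻χ₃-integral : IntegralEGF (binomial⁻ χ₃)
  binomial⁻χ₃-integral n =
    ∣ₚ-∣-trans (n!∣ₚ3^⌊[n-1]/2⌋ n) (3^⌊[n-1]/2⌋∣ {binomial⁻ χ₃} (binomial⁻-periodic₃ {χ₃} (λ _ → refl)) n)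

  binomialW-integral : IntegralEGF (binomial W)
  binomialW-integral =
    ⋆-inverse-integral refl (λ n → trans (binomial⁻⋆binomial n χ₃ W) (χ₃⋆W≡δ₀ n)) binomial⁻χ₃-integral

  binomial[W↑M]-integral : ∀ M → IntegralEGF (binomial (W ↑ M))
  binomial[W↑M]-integral M j =
    subst (+ (j !) ∣ₚ_) (binomial⁻-binomial-↑ M j W) (j!∣ₚbinomial⁻[u↑j] binomialW-integral j M)

  9∣binomial[W↑M]3 : ∀ M → 3 ℕ.∣ M → + 9 ∣ binomial (W ↑ M) 3
  9∣binomial[W↑M]3 M 3∣M = subst (+ 9 ∣_) (binomial⁻-binomial-↑ M 3 W) (∣-sum≤ M term)
    where
    term : ∀ i → i ≤ M → + 9 ∣ + (M C i) * (-1^ (M ∸ i) * binomial W (i ℕ.+ 3))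
    term zero    _ = ∣n⇒∣m*n (+ (M C 0)) (∣n⇒∣m*n (-1^ M) (divides 0ℤ refl))
    term (suc i) _ = p^e∣-∣ₚ-trans 2 (subst (+ 9 ∣_) (ℤ.pos-* (M C suc i) _) (∣ᵤ⇒∣ (9∣MC[1+i]*[1+i+3]! M i 3∣M)))
      (*-pres-∣ₚ {x₁ = + (M C suc i)} (∣⇒∣ₚ ∣-refl) (∣ₚ-*ˡ (-1^ (M ∸ suc i)) (binomialW-integral (suc i ℕ.+ 3))))

  W[4+L′+M]-W[M]-expansion : ∀ L′ M → -1^ L′ ≡ 1ℤ → 3 ℕ.∣ M →
    let L = 4 ℕ.+ L′
        T = binomial (W ↑ M)
    in W (L ℕ.+ M) - W M ≡ (+ (L C 2) - + (L C 1)) * W M - + (L C 3) * T 3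
                           + ∑[ j ≤ L′ ] (+ (L C (4 ℕ.+ j)) * (-1^ (L′ ∸ j) * T (4 ℕ.+ j)))
  W[4+L′+M]-W[M]-expansion L′ M -1^L′≡1 3∣M = begin
    W (L ℕ.+ M) - W M                       ≡⟨ cong (_- W M) (binomial⁻-inverseˡ L (W ↑ M)) ⟨
    binomial⁻ T L - W M                     ≡⟨⟩
    E (-1^ L′) (W (1 ℕ.+ M)) (W (2 ℕ.+ M))  ≡⟨ cong (λ s → E s (W (1 ℕ.+ M)) (W (2 ℕ.+ M))) -1^L′≡1 ⟩
    E 1ℤ (W (1 ℕ.+ M)) (W (2 ℕ.+ M))        ≡⟨ cong₂ (E 1ℤ) (W-∤ (1 ℕ.+ M) (∤m∣n⇒∤m+n 3∤1 3∣M))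
                                                            (W-∤ (2 ℕ.+ M) (∤m∣n⇒∤m+n 3∤2 3∣M)) ⟩
    E 1ℤ 0ℤ 0ℤ                              ≡⟨ collect (+ (L C 1)) (+ (L C 2)) (+ (L C 3)) (W M) (T 3) tail ⟩
    (+ (L C 2) - + (L C 1)) * W M - + (L C 3) * T 3 + tail ∎
    where
    open ≡-Reasoning
    L : ℕ
    L = 4 ℕ.+ L′
    T : ℕ → ℤ
    T = binomial (W ↑ M)
    tail : ℤ
    tail = ∑[ j ≤ L′ ] (+ (L C (4 ℕ.+ j)) * (-1^ (L′ ∸ j) * T (4 ℕ.+ j)))
    -- binomial⁻ T L - W M unfolded, as a function of s = -1^ L′, y₁ = W (1 + M) and y₂ = W (2 + M).
    E : ℤ → ℤ → ℤ → ℤ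
    E s y₁ y₂ = 1ℤ * (- - - - s * (1ℤ * W M))
              + (+ (L C 1) * (- - - s * (1ℤ * W M + 1ℤ * y₁))
              + (+ (L C 2) * (- - s * (1ℤ * W M + (+ 2 * y₁ + 1ℤ * y₂)))
              + (+ (L C 3) * (- s * T 3) + tail)))
              - W M
    collect : ∀ c₁ c₂ c₃ w t r →
              1ℤ * (- - - - 1ℤ * (1ℤ * w)) + (c₁ * (- - - 1ℤ * (1ℤ * w + 1ℤ * 0ℤ))
              + (c₂ * (- - 1ℤ * (1ℤ * w + (+ 2 * 0ℤ + 1ℤ * 0ℤ))) + (c₃ * (- 1ℤ * t) + r))) - w
              ≡ (c₂ - c₁) * w - c₃ * t + r
    collect = solve-∀

  3^[2+k]∣W[L+M]-W[M] : ∀ k L M → 3 ^ suc k ℕ.∣ L → 2 ℕ.∣ L → 3 ℕ.∣ M → + (3 ^ (2 ℕ.+ k)) ∣ W (L ℕ.+ M) - W M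
  3^[2+k]∣W[L+M]-W[M] k 0 M _ _ _ = subst (_ ∣_) (sym (ℤ.+-inverseʳ (W M))) (divides 0ℤ refl)
  3^[2+k]∣W[L+M]-W[M] k 1 M 3^[1+k]∣1 _ _ = contradiction (ℕ.∣-trans (3∣3^[1+k] k) 3^[1+k]∣1) 3∤1
  3^[2+k]∣W[L+M]-W[M] k 2 M 3^[1+k]∣2 _ _ = contradiction (ℕ.∣-trans (3∣3^[1+k] k) 3^[1+k]∣2) 3∤2
  3^[2+k]∣W[L+M]-W[M] k 3 M _ 2∣3 _ = contradiction 2∣3 (from-no (2 ℕ.∣? 3))
  3^[2+k]∣W[L+M]-W[M] k L@(suc (suc (suc (suc L′)))) M 3^[1+k]∣L 2∣L 3∣M =
    subst (_ ∣_) (sym (W[4+L′+M]-W[M]-expansion L′ M (-1^-even L′ 2∣L′) 3∣M))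
      (∣m∣n⇒∣m+n (∣m∣n⇒∣m-n (∣m⇒∣m*n (W M) (3^[2+k]∣LC2-LC1 k L 3^[1+k]∣L)) 3^[2+k]∣LC3*T3)
                 (∣-sum≤ L′ (λ j _ → 3^[2+k]∣tail-term j)))
    where
    T : ℕ → ℤ
    T = binomial (W ↑ M)
    2∣L′ : 2 ℕ.∣ L′
    2∣L′ = ℕ.∣m+n∣m⇒∣n 2∣L (ℕ.divides 2 refl)
    3^[2+k]∣LC3*T3 : + (3 ^ (2 ℕ.+ k)) ∣ + (L C 3) * T 3
    3^[2+k]∣LC3*T3 = subst (_∣ + (L C 3) * T 3) 3^k*9≡3^[2+k]
      (*-pres-∣ {+ (3 ^ k)} {+ (L C 3)} (∣ᵤ⇒∣ (3^k∣LC3 k L 3^[1+k]∣L)) (9∣binomial[W↑M]3 M 3∣M))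
      where
      3^k*9≡3^[2+k] : + (3 ^ k) * + 9 ≡ + (3 ^ (2 ℕ.+ k))
      3^k*9≡3^[2+k] = trans (sym (ℤ.pos-* (3 ^ k) 9)) (cong +_ (trans (ℕ.*-comm (3 ^ k) 9) (sym (ℕ.^-distribˡ-+-* 3 2 k))))
    3^[2+k]∣tail-term : ∀ j → + (3 ^ (2 ℕ.+ k)) ∣ + (L C (4 ℕ.+ j)) * (-1^ (L′ ∸ j) * T (4 ℕ.+ j))
    3^[2+k]∣tail-term j = p^e∣-∣ₚ-trans (2 ℕ.+ k)
      (subst (_ ∣_) (ℤ.pos-* (L C (4 ℕ.+ j)) _)
             (∣ᵤ⇒∣ (3^[2+k]∣LC[1+j]*[1+j]! k L (3 ℕ.+ j) 3^[1+k]∣L (ℕ.m≤m+n 3 j))))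
      (*-pres-∣ₚ {x₁ = + (L C (4 ℕ.+ j))} (∣⇒∣ₚ ∣-refl)
                 (∣ₚ-*ˡ (-1^ (L′ ∸ j)) (binomial[W↑M]-integral M (4 ℕ.+ j))))

  W-congruence-≤ : ∀ k {M N} → M ≤ N → 3 ℕ.∣ M →
                   + (2 ℕ.* 3 ^ suc k) ∣ᵤ + N - + M → + (3 ^ (2 ℕ.+ k)) ∣ᵤ W N - W M
  W-congruence-≤ k {M} {N} M≤N 3∣M 2·3^[1+k]∣N-M =
    ∣⇒∣ᵤ (subst (λ x → + (3 ^ (2 ℕ.+ k)) ∣ W x - W M) (ℕ.m∸n+n≡m M≤N)
                (3^[2+k]∣W[L+M]-W[M] k (N ∸ M) M 3^[1+k]∣N∸M 2∣N∸M 3∣M))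
    where
    2·3^[1+k]∣N∸M : 2 ℕ.* 3 ^ suc k ℕ.∣ N ∸ M
    2·3^[1+k]∣N∸M = subst (2 ℕ.* 3 ^ suc k ℕ.∣_) (cong ℤ.∣_∣ (trans (ℤ.[+m]-[+n]≡m⊖n N M) (ℤ.⊖-≥ M≤N))) 2·3^[1+k]∣N-M
    3^[1+k]∣N∸M : 3 ^ suc k ℕ.∣ N ∸ M
    3^[1+k]∣N∸M = ℕ.∣-trans (ℕ.n∣m*n 2) 2·3^[1+k]∣N∸M
    2∣N∸M : 2 ℕ.∣ N ∸ M
    2∣N∸M = ℕ.∣-trans (ℕ.m∣m*n (3 ^ suc k)) 2·3^[1+k]∣N∸M

  ∣ᵤ-swap : ∀ {d} a b → d ∣ᵤ a - b → d ∣ᵤ b - a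
  ∣ᵤ-swap a b = subst (_ ℕ.∣_) (ℤ.∣i-j∣≡∣j-i∣ a b)

  W-congruence : ∀ k M N → 3 ℕ.∣ M → 3 ℕ.∣ N →
                 + (2 ℕ.* 3 ^ suc k) ∣ᵤ + N - + M → + (3 ^ (2 ℕ.+ k)) ∣ᵤ W N - W M
  W-congruence k M N 3∣M 3∣N 2·3^[1+k]∣N-M with ℕ.≤-total M N
  ... | inj₁ M≤N = W-congruence-≤ k M≤N 3∣M 2·3^[1+k]∣N-M
  ... | inj₂ N≤M = ∣ᵤ-swap {+ (3 ^ (2 ℕ.+ k))} (W M) (W N)
                     (W-congruence-≤ k N≤M 3∣N (∣ᵤ-swap {+ (2 ℕ.* 3 ^ suc k)} (+ N) (+ M) 2·3^[1+k]∣N-M))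

open import Defs
open import Data.Nat using (ℕ; suc; _^_)
open import Data.Integer using (+_; _-_)
open import Data.Integer.Divisibility using (_∣_)
import Data.Nat as N
open import Data.Nat.Divisibility using (m∣m*n)
open LehmerNumbers using (W-congruence)

corollary3p6 : (n m k : ℕ) → 1 N.≤ k →
    (+ (2 N.* 3 ^ k)) ∣ ((+ (3 N.* n)) - (+ (3 N.* m))) →
    (+ (3 ^ suc k)) ∣ (W (3 N.* n) - W (3 N.* m))
corollary3p6 n m 0       ()
corollary3p6 n m (suc k) _ = W-congruence k (3 N.* m) (3 N.* n) (m∣m*n m) (m∣m*n n)
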